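{- Let $M$ be a positive integer, $z$ an integer, and let $\alpha,\beta$ be positive integers with $\max(\alpha,\beta) < M/\gcd(M,z)$. Suppose that, over $w = 1, 2, \ldots, \max(\alpha,\beta)$, the value $(\beta \times z) \bmod M$ is the maximum of $(w \times z) \bmod M$ and $(\alpha \times z) \bmod M$ is the minimum of $(w \times z) \bmod M$. Consider the extended range $w = 1, 2, \ldots, \alpha+\beta$. Then: (i) if $((\alpha+\beta)\times z) \bmod M > (\beta\times z) \bmod M$, then $((\alpha+\beta)\times z) \bmod M$ is the maximum of $(w\times z)\bmod M$ over $w=1,\ldots,\alpha+\beta$, and $(\alpha\times z)\bmod M$ is still the minimum of $(w\times z)\bmod M$ over $w=1,\ldots,\alpha+\beta$; (ii) otherwise, $((\alpha+\beta)\times z) \bmod M < (\beta\times z) \bmod M$, the value $((\alpha+\beta)\times z) \bmod M$ is the minimum of $(w\times z)\bmod M$ over $w=1,\ldots,\alpha+\beta$, and $(\beta\times z)\bmod M$ is still the maximum of $(w\times z)\bmod M$ over $w=1,\ldots,\alpha+\beta$.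
   Context: For an integer $a$ and positive integer $M$, $a \bmod M = a - \lfloor a/M\rfloor \times M \in \{0,\dots,M-1\}$. $\gcd(M,z)$ denotes the greatest common divisor. -}

module Defs where

open import Data.Nat using (ℕ; NonZero; _≤_)
open import Data.Integer using (ℤ; +_; _*_)
open import Data.Integer.DivMod using (_%ℕ_)

res : (M : ℕ) .{{_ : NonZero M}} → ℤ → ℕ → ℕ
res M z w = ((+ w) * z) %ℕ M

-- v is the maximum of f w over w = 1, …, n  (an upper bound; attainment holds as v is given as f of an in-range point)
IsMaxOn : (ℕ → ℕ) → ℕ → ℕ → Set
IsMaxOn f n v = (∀ w → 1 ≤ w → w ≤ n → f w ≤ v)

IsMinOn : (ℕ → ℕ) → ℕ → ℕ → Set
IsMinOn f n v = (∀ w → 1 ≤ w → w ≤ n → v ≤ f w)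

-- The residues r w = (w z) mod M add with at most one carry: r (x + y) is r x + r y or r x + r y − M.
-- If r β < r (α + β) there is no carry at α + β, and every w in (α ⊔ β, α + β] is α + s with
-- s ≤ β, again without carry, so r w = r α + r s lies between r α and r α + r β = r (α + β).
-- Otherwise r α > 0 (as α gcd(M, z) < M, M cannot divide α z) forces a carry at α + β, and
-- writing such w as t + β with t ≤ α forces a carry there too, so r w lies between
-- r (α + β) = r α + r β − M and r β.
module Submission where

open import Data.Nat as ℕ using (ℕ; NonZero; _+_; _*_; _<_; _≤_; _⊔_; _∸_; ≢-nonZero; ≢-nonZero⁻¹; >-nonZero)
open import Data.Nat.Properties as ℕ
  using ( +-mono-<; +-monoˡ-<; +-monoʳ-<; +-monoˡ-≤; +-monoʳ-≤; +-cancelʳ-<; +-cancelʳ-≤; *-cancelʳ-<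
        ; *-monoˡ-≤; m*n≢0; m∸n+n≡m; m+[n∸m]≡n; m<n⇒0<n∸m; m≤n+o⇒m∸n≤o; m≤m+n; m≤n+m; m≤m⊔n; m≤n⊔m
        ; m≤n⇒m≤n⊔o; m≤n⇒m≤o⊔n; ⊔-lub; ≤-trans; ≤-<-trans; <⇒≤; <⇒≱; ≤⇒≯; ≮⇒≥; ≰⇒>; <-asym
        ; n<1⇒n≡0; n≢0⇒n>0)
open import Data.Nat.Divisibility using (_∣_; divides; n∣m*n; >⇒∤)
open import Data.Nat.GCD using (gcd; gcd-greatest; gcd[m,n]≢0; c*gcd[m,n]≡gcd[cm,cn])
open import Data.Integer as ℤ using (ℤ; +_; ∣_∣; 1ℤ; _⊖_)
open import Data.Integer.Properties as ℤ
  using (+-injective; pos-+; abs-*; i-j≡0⇒i≡j; ∣i∣≡0⇒i≡0; [+m]-[+n]≡m⊖n; ∣m⊝n∣≤m⊔n)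
open import Data.Integer.DivMod using (_%ℕ_; _/ℕ_; a≡a%ℕn+[a/ℕn]*n; n%ℕd<d)
open import Data.Integer.Solver using (module +-*-Solver)
open import Data.Product using (_×_; _,_)
open import Data.Sum using (_⊎_; inj₁; inj₂)
open import Relation.Binary.PropositionalEquality
open import Relation.Nullary using (yes; no; contradiction)

open import Defs

open +-*-Solver

AddsWithCarry : ℕ → ℕ → ℕ → ℕ → Set
AddsWithCarry M a b c = c ≡ a + b ⊎ c + M ≡ a + b

module _ (M : ℕ) .{{_ : NonZero M}} where

  a-b≡k*M⇒a≡b : ∀ {a b} (k : ℤ) → a < M → b < M → + a ℤ.- + b ≡ k ℤ.* + M → a ≡ b
  a-b≡k*M⇒a≡b {a} {b} k a<M b<M a-b≡kM = +-injective (i-j≡0⇒i≡j (+ a) (+ b) a-b≡0)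
    where
    ∣k∣M<1M : ∣ k ∣ * M < 1 * M
    ∣k∣M<1M = begin-strict
      ∣ k ∣ * M              ≡⟨ abs-* k (+ M) ⟨
      ∣ k ℤ.* + M ∣          ≡⟨ cong ∣_∣ (trans (sym a-b≡kM) ([+m]-[+n]≡m⊖n a b)) ⟩
      ∣ a ⊖ b ∣              ≤⟨ ∣m⊝n∣≤m⊔n a b ⟩
      a ⊔ b                  <⟨ ⊔-lub a<M b<M ⟩
      M                      ≡⟨ ℕ.*-identityˡ M ⟨
      1 * M                  ∎
      where open ℕ.≤-Reasoning
    a-b≡0 : + a ℤ.- + b ≡ + 0
    a-b≡0 = begin
      + a ℤ.- + b  ≡⟨ a-b≡kM ⟩
      k ℤ.* + M    ≡⟨ cong (ℤ._* + M) (∣i∣≡0⇒i≡0 {k} (n<1⇒n≡0 (*-cancelʳ-< M ∣ k ∣ 1 ∣k∣M<1M))) ⟩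
      + 0          ∎
      where open ≡-Reasoning

  %ℕ-unique : ∀ i k {r} → r < M → i ≡ + r ℤ.+ k ℤ.* + M → i %ℕ M ≡ r
  %ℕ-unique i k {r} r<M i≡r+kM = a-b≡k*M⇒a≡b (k ℤ.- i /ℕ M) (n%ℕd<d i M) r<M (begin
      + (i %ℕ M) ℤ.- + r
        ≡⟨ solve 5 (λ r′ r q′ q m → r′ :- r := (r′ :+ q′ :* m) :- (r :+ q :* m) :+ (q :- q′) :* m)
             refl (+ (i %ℕ M)) (+ r) (i /ℕ M) k (+ M) ⟩
      (+ (i %ℕ M) ℤ.+ i /ℕ M ℤ.* + M) ℤ.- (+ r ℤ.+ k ℤ.* + M) ℤ.+ (k ℤ.- i /ℕ M) ℤ.* + M
        ≡⟨ cong (λ j → j ℤ.- (+ r ℤ.+ k ℤ.* + M) ℤ.+ (k ℤ.- i /ℕ M) ℤ.* + M)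
             (trans (sym (a≡a%ℕn+[a/ℕn]*n i M)) i≡r+kM) ⟩
      (+ r ℤ.+ k ℤ.* + M) ℤ.- (+ r ℤ.+ k ℤ.* + M) ℤ.+ (k ℤ.- i /ℕ M) ℤ.* + M
        ≡⟨ solve 4 (λ r q q′ m → (r :+ q :* m) :- (r :+ q :* m) :+ (q :- q′) :* m := (q :- q′) :* m)
             refl (+ r) k (i /ℕ M) (+ M) ⟩
      (k ℤ.- i /ℕ M) ℤ.* + M ∎)
    where open ≡-Reasoning

  a+b≡a%ℕn+b%ℕn+[a/ℕn+b/ℕn]*n : ∀ i j →
    i ℤ.+ j ≡ + (i %ℕ M + j %ℕ M) ℤ.+ (i /ℕ M ℤ.+ j /ℕ M) ℤ.* + M
  a+b≡a%ℕn+b%ℕn+[a/ℕn+b/ℕn]*n i j = begin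
    i ℤ.+ j
      ≡⟨ cong₂ ℤ._+_ (a≡a%ℕn+[a/ℕn]*n i M) (a≡a%ℕn+[a/ℕn]*n j M) ⟩
    (+ (i %ℕ M) ℤ.+ i /ℕ M ℤ.* + M) ℤ.+ (+ (j %ℕ M) ℤ.+ j /ℕ M ℤ.* + M)
      ≡⟨ solve 5 (λ r s p q m → (r :+ p :* m) :+ (s :+ q :* m) := (r :+ s) :+ (p :+ q) :* m)
           refl (+ (i %ℕ M)) (+ (j %ℕ M)) (i /ℕ M) (j /ℕ M) (+ M) ⟩
    (+ (i %ℕ M) ℤ.+ + (j %ℕ M)) ℤ.+ (i /ℕ M ℤ.+ j /ℕ M) ℤ.* + M
      ≡⟨ cong (ℤ._+ (i /ℕ M ℤ.+ j /ℕ M) ℤ.* + M) (pos-+ (i %ℕ M) (j %ℕ M)) ⟨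
    + (i %ℕ M + j %ℕ M) ℤ.+ (i /ℕ M ℤ.+ j /ℕ M) ℤ.* + M ∎
    where open ≡-Reasoning

  %ℕ-+ : ∀ i j → AddsWithCarry M (i %ℕ M) (j %ℕ M) ((i ℤ.+ j) %ℕ M)
  %ℕ-+ i j with i %ℕ M + j %ℕ M ℕ.<? M
  ... | yes s<M =
    inj₁ (%ℕ-unique (i ℤ.+ j) (i /ℕ M ℤ.+ j /ℕ M) s<M (a+b≡a%ℕn+b%ℕn+[a/ℕn+b/ℕn]*n i j))
  ... | no s≮M =
    inj₂ (trans (cong (_+ M) (%ℕ-unique (i ℤ.+ j) (q ℤ.+ 1ℤ) t<M i+j≡t+[q+1]M)) (m∸n+n≡m M≤s))
    where
    q : ℤ
    q = i /ℕ M ℤ.+ j /ℕ M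
    M≤s : M ≤ i %ℕ M + j %ℕ M
    M≤s = ≮⇒≥ s≮M
    t : ℕ
    t = i %ℕ M + j %ℕ M ∸ M
    t<M : t < M
    t<M = +-cancelʳ-< M t M
      (subst (_< M + M) (sym (m∸n+n≡m M≤s)) (+-mono-< (n%ℕd<d i M) (n%ℕd<d j M)))
    i+j≡t+[q+1]M : i ℤ.+ j ≡ + t ℤ.+ (q ℤ.+ 1ℤ) ℤ.* + M
    i+j≡t+[q+1]M = begin
      i ℤ.+ j                            ≡⟨ a+b≡a%ℕn+b%ℕn+[a/ℕn+b/ℕn]*n i j ⟩
      + (i %ℕ M + j %ℕ M) ℤ.+ q ℤ.* + M  ≡⟨ cong (λ s → + s ℤ.+ q ℤ.* + M) (m∸n+n≡m M≤s) ⟨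
      + (t + M) ℤ.+ q ℤ.* + M            ≡⟨ cong (ℤ._+ q ℤ.* + M) (pos-+ t M) ⟩
      + t ℤ.+ + M ℤ.+ q ℤ.* + M          ≡⟨ solve 3 (λ t m q → t :+ m :+ q :* m := t :+ (q :+ con 1ℤ) :* m)
                                              refl (+ t) (+ M) q ⟩
      + t ℤ.+ (q ℤ.+ 1ℤ) ℤ.* + M         ∎
      where open ≡-Reasoning

  %ℕ≡0⇒∣ : ∀ i → i %ℕ M ≡ 0 → M ∣ ∣ i ∣
  %ℕ≡0⇒∣ i i%M≡0 = divides ∣ i /ℕ M ∣ (begin
    ∣ i ∣                              ≡⟨ cong ∣_∣ (a≡a%ℕn+[a/ℕn]*n i M) ⟩
    ∣ + (i %ℕ M) ℤ.+ i /ℕ M ℤ.* + M ∣  ≡⟨ cong (λ r → ∣ + r ℤ.+ i /ℕ M ℤ.* + M ∣) i%M≡0 ⟩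
    ∣ + 0 ℤ.+ i /ℕ M ℤ.* + M ∣        ≡⟨ cong ∣_∣ (ℤ.+-identityˡ (i /ℕ M ℤ.* + M)) ⟩
    ∣ i /ℕ M ℤ.* + M ∣                ≡⟨ abs-* (i /ℕ M) (+ M) ⟩
    ∣ i /ℕ M ∣ * M                    ∎)
    where open ≡-Reasoning

All1To : ℕ → (ℕ → Set) → Set
All1To n P = ∀ w → 1 ≤ w → w ≤ n → P w

All1To-+ˡ : ∀ {P : ℕ → Set} α β → All1To (α ⊔ β) P → All1To β (λ s → P (α + s)) → All1To (α + β) P
All1To-+ˡ {P} α β P-low P-shifted w 1≤w w≤α+β with w ℕ.≤? α ⊔ β
... | yes w≤α⊔β = P-low w 1≤w w≤α⊔β
... | no w≰α⊔β = subst P (m+[n∸m]≡n (<⇒≤ α<w))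
                   (P-shifted (w ∸ α) (m<n⇒0<n∸m α<w) (m≤n+o⇒m∸n≤o w α w≤α+β))
  where
  α<w : α < w
  α<w = ≤-<-trans (m≤m⊔n α β) (≰⇒> w≰α⊔β)

All1To-+ʳ : ∀ {P : ℕ → Set} α β → All1To (α ⊔ β) P → All1To α (λ t → P (t + β)) → All1To (α + β) P
All1To-+ʳ {P} α β P-low P-shifted w 1≤w w≤α+β with w ℕ.≤? α ⊔ β
... | yes w≤α⊔β = P-low w 1≤w w≤α⊔β
... | no w≰α⊔β = subst P (m∸n+n≡m (<⇒≤ β<w))
                   (P-shifted (w ∸ β) (m<n⇒0<n∸m β<w)
                              (m≤n+o⇒m∸n≤o w β (subst (w ≤_) (ℕ.+-comm α β) w≤α+β)))
  where
  β<w : β < w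
  β<w = ≤-<-trans (m≤n⊔m α β) (≰⇒> w≰α⊔β)

module _ {M : ℕ} {f : ℕ → ℕ} (f<M : ∀ w → f w < M)
         (f-+ : ∀ x y → AddsWithCarry M (f x) (f y) (f (x + y))) where

  carry⇒<ˡ : ∀ {x y} → f (x + y) + M ≡ f x + f y → f (x + y) < f x
  carry⇒<ˡ {x} {y} carry = +-cancelʳ-< M (f (x + y)) (f x)
    (subst (_< f x + M) (sym carry) (+-monoʳ-< (f x) (f<M y)))

  carry⇒<ʳ : ∀ {x y} → f (x + y) + M ≡ f x + f y → f (x + y) < f y
  carry⇒<ʳ {x} {y} carry = +-cancelʳ-< M (f (x + y)) (f y)
    (subst₂ _<_ (sym carry) (ℕ.+-comm M (f y)) (+-monoˡ-< (f y) (f<M x)))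

  <⇒no-carry : ∀ {x y} → f x + f y < M → f (x + y) ≡ f x + f y
  <⇒no-carry {x} {y} sum<M with f-+ x y
  ... | inj₁ no-carry = no-carry
  ... | inj₂ carry = contradiction (subst (M ≤_) carry (m≤n+m M (f (x + y)))) (<⇒≱ sum<M)

  ≥⇒carry : ∀ {x y} → M ≤ f x + f y → f (x + y) + M ≡ f x + f y
  ≥⇒carry {x} {y} M≤sum with f-+ x y
  ... | inj₁ no-carry = contradiction (subst (M ≤_) (sym no-carry) M≤sum) (<⇒≱ (f<M (x + y)))
  ... | inj₂ carry = carry

  module _ (α β : ℕ) (max : IsMaxOn f (α ⊔ β) (f β)) (min : IsMinOn f (α ⊔ β) (f α)) where

    extremes-rising : f β < f (α + β) →
      IsMaxOn f (α + β) (f (α + β)) × IsMinOn f (α + β) (f α)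
    extremes-rising fβ<fα+β =
        All1To-+ˡ α β (λ w 1≤w w≤α⊔β → ≤-trans (max w 1≤w w≤α⊔β) (<⇒≤ fβ<fα+β))
                      (λ s 1≤s s≤β → subst₂ _≤_ (sym (fα+s≡fα+fs s 1≤s s≤β)) (sym fα+β≡fα+fβ)
                                       (+-monoʳ-≤ (f α) (max s 1≤s (m≤n⇒m≤o⊔n α s≤β))))
      , All1To-+ˡ α β min
                      (λ s 1≤s s≤β → subst (f α ≤_) (sym (fα+s≡fα+fs s 1≤s s≤β)) (m≤m+n (f α) (f s)))
      where
      fα+β≡fα+fβ : f (α + β) ≡ f α + f β
      fα+β≡fα+fβ with f-+ α β
      ... | inj₁ no-carry = no-carry
      ... | inj₂ carry = contradiction (carry⇒<ʳ carry) (<-asym fβ<fα+β)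
      fα+s≡fα+fs : ∀ s → 1 ≤ s → s ≤ β → f (α + s) ≡ f α + f s
      fα+s≡fα+fs s 1≤s s≤β = <⇒no-carry (≤-<-trans (+-monoʳ-≤ (f α) (max s 1≤s (m≤n⇒m≤o⊔n α s≤β)))
                                                     (subst (_< M) fα+β≡fα+fβ (f<M (α + β))))

    extremes-falling : 0 < f α → f (α + β) ≤ f β →
      f (α + β) < f β × IsMinOn f (α + β) (f (α + β)) × IsMaxOn f (α + β) (f β)
    extremes-falling 0<fα fα+β≤fβ =
        carry⇒<ʳ fα+β+M≡fα+fβ
      , All1To-+ʳ α β (λ w 1≤w w≤α⊔β → ≤-trans (<⇒≤ (carry⇒<ˡ fα+β+M≡fα+fβ)) (min w 1≤w w≤α⊔β))
                      (λ t 1≤t t≤α → +-cancelʳ-≤ M (f (α + β)) (f (t + β))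
                                       (subst (f (α + β) + M ≤_) (sym (ft+β+M≡ft+fβ t 1≤t t≤α))
                                              (fα+β+M≤ft+fβ t 1≤t t≤α)))
      , All1To-+ʳ α β max (λ t 1≤t t≤α → <⇒≤ (carry⇒<ʳ (ft+β+M≡ft+fβ t 1≤t t≤α)))
      where
      fα+β+M≡fα+fβ : f (α + β) + M ≡ f α + f β
      fα+β+M≡fα+fβ with f-+ α β
      ... | inj₁ no-carry =
        contradiction (subst (f β <_) (sym no-carry) (+-monoˡ-< (f β) 0<fα)) (≤⇒≯ fα+β≤fβ)
      ... | inj₂ carry = carry
      fα+β+M≤ft+fβ : ∀ t → 1 ≤ t → t ≤ α → f (α + β) + M ≤ f t + f β
      fα+β+M≤ft+fβ t 1≤t t≤α = subst (_≤ f t + f β) (sym fα+β+M≡fα+fβ)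
                                     (+-monoˡ-≤ (f β) (min t 1≤t (m≤n⇒m≤n⊔o β t≤α)))
      ft+β+M≡ft+fβ : ∀ t → 1 ≤ t → t ≤ α → f (t + β) + M ≡ f t + f β
      ft+β+M≡ft+fβ t 1≤t t≤α = ≥⇒carry (≤-trans (m≤n+m M (f (α + β))) (fα+β+M≤ft+fβ t 1≤t t≤α))

module _ (M : ℕ) .{{_ : NonZero M}} (z : ℤ) where

  res<M : ∀ w → res M z w < M
  res<M w = n%ℕd<d (+ w ℤ.* z) M

  res-+ : ∀ x y → AddsWithCarry M (res M z x) (res M z y) (res M z (x + y))
  res-+ x y = subst (λ i → AddsWithCarry M (res M z x) (res M z y) (i %ℕ M))
    (sym (trans (cong (ℤ._* z) (pos-+ x y)) (ℤ.*-distribʳ-+ z (+ x) (+ y))))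
    (%ℕ-+ M (+ x ℤ.* z) (+ y ℤ.* z))

  res-pos : ∀ {α} → 1 ≤ α → α * gcd M ∣ z ∣ < M → 0 < res M z α
  res-pos {α} 1≤α αg<M = n≢0⇒n>0 λ resα≡0 → >⇒∤ {{αg≢0}} αg<M (M∣αg resα≡0)
    where
    αg≢0 : NonZero (α * gcd M ∣ z ∣)
    αg≢0 = m*n≢0 α (gcd M ∣ z ∣)
      {{>-nonZero 1≤α}} {{≢-nonZero (gcd[m,n]≢0 M ∣ z ∣ (inj₁ (≢-nonZero⁻¹ M)))}}
    M∣αg : res M z α ≡ 0 → M ∣ (α * gcd M ∣ z ∣)
    M∣αg resα≡0 = subst (M ∣_) (sym (c*gcd[m,n]≡gcd[cm,cn] α M ∣ z ∣))
      (gcd-greatest (n∣m*n α) (subst (M ∣_) (abs-* (+ α) z) (%ℕ≡0⇒∣ M (+ α ℤ.* z) resα≡0)))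

lemma3 : (M : ℕ) .{{_ : NonZero M}} (z : ℤ) (α β : ℕ) →
    1 ≤ α → 1 ≤ β →
    (α ⊔ β) * gcd M ∣ z ∣ < M →
    IsMaxOn (res M z) (α ⊔ β) (res M z β) →
    IsMinOn (res M z) (α ⊔ β) (res M z α) →
    (res M z β < res M z (α + β) →
      IsMaxOn (res M z) (α + β) (res M z (α + β))
      × IsMinOn (res M z) (α + β) (res M z α))
    × (res M z (α + β) ≤ res M z β →
      res M z (α + β) < res M z β
      × IsMinOn (res M z) (α + β) (res M z (α + β))
      × IsMaxOn (res M z) (α + β) (res M z β))
lemma3 M z α β 1≤α _ bound max min =
    extremes-rising (res<M M z) (res-+ M z) α β max min
  , extremes-falling (res<M M z) (res-+ M z) α β max min
      (res-pos M z 1≤α (≤-<-trans (*-monoˡ-≤ (gcd M ∣ z ∣) (m≤m⊔n α β)) bound))
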